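{- Let $F$ be a finite field, let $k, m, n \in \mathbb{N}$, let $q := |F|$, and let $p_1,\ldots, p_m \in F[x_1,\ldots, x_n]$ be polynomials such that for each $i \in \{1,\ldots,m\}$, each monomial of $p_i$ contains at most $k$ variables. Then there exists $J \subseteq \{1,\ldots,n\}$ such that $|J| \le k m (q-1)$ and $p_i (\mathbf{1}|_{J}) = p_i (\mathbf{1})$ for all $i \in \{1,\ldots,m\}$.
   Context: $\mathbb{N}=\{1,2,3,\ldots\}$. $\mathbf{1}$ denotes the vector $(1,1,\ldots,1)\in F^n$, and for $J \subseteq \{1,\ldots,n\}$, $\mathbf{1}|_{J}$ denotes the vector $(v_1,\ldots,v_n)\in F^n$ with $v_j = 1$ if $j \in J$ and $v_j = 0$ if $j \notin J$. -}

module Defs where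

open import Level using (Level; _⊔_)
open import Data.Nat using (ℕ; zero; suc; _≤_)
open import Data.Fin using (Fin; zero; suc)
open import Data.Bool using (Bool; true; false; if_then_else_)
open import Data.List using (List; []; _∷_)
open import Data.Product using (_×_; _,_; Σ; ∃)
open import Relation.Nullary using (¬_)
open import Algebra.Bundles using (CommutativeRing)
open import Function.Definitions using (Injective; Surjective)
open import Relation.Binary.PropositionalEquality using (_≡_)

record Field (c ℓ : Level) : Set (Level.suc (c ⊔ ℓ)) where
  field
    commutativeRing : CommutativeRing c ℓ
  open CommutativeRing commutativeRing public
  field
    0≉1     : ¬ (0# ≈ 1#)
    inverse : ∀ x → ¬ (x ≈ 0#) → ∃ λ y → x * y ≈ 1#

record HasCardinality {c ℓ} (F : Field c ℓ) (q : ℕ) : Set (c ⊔ ℓ) where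
  open Field F using (Carrier; _≈_)
  field
    enum       : Fin q → Carrier
    enum-inj   : Injective _≡_ _≈_ enum
    enum-surj  : Surjective _≡_ _≈_ enum

module _ {c ℓ} (F : Field c ℓ) where
  open Field F using (Carrier; _+_; _*_; 0#; 1#)

  pow : Carrier → ℕ → Carrier
  pow x zero    = 1#
  pow x (suc e) = x * pow x e

  Monomial : ℕ → Set
  Monomial n = Fin n → ℕ

  Poly : ℕ → Set c
  Poly n = List (Carrier × Monomial n)

  evalMono : ∀ {n} → Monomial n → (Fin n → Carrier) → Carrier
  evalMono {zero}  e x = 1#
  evalMono {suc n} e x = pow (x zero) (e zero) * evalMono (λ i → e (suc i)) (λ i → x (suc i))

  eval : ∀ {n} → Poly n → (Fin n → Carrier) → Carrier
  eval []            x = 0#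
  eval ((a , e) ∷ p) x = a * evalMono e x + eval p x

  ones : ∀ {n} → Fin n → Carrier
  ones _ = 1#

  indicator : ∀ {n} → (Fin n → Bool) → Fin n → Carrier
  indicator J j = if J j then 1# else 0#

numVars : ∀ {n} → (Fin n → ℕ) → ℕ
numVars {zero}  e = zero
numVars {suc n} e with e zero
... | zero  = numVars (λ i → e (suc i))
... | suc _ = suc (numVars (λ i → e (suc i)))

-- View the polynomials as functions of the subset J ⊆ {1..n}.  On indicator
-- vectors a monomial in at most k variables is the function [T ⊆ J] for some
-- T with |T| ≤ k, and z ↦ ∏_{a ≠ 0} (1 - z/a) is the indicator of z = 0, a
-- polynomial of degree q - 1.  Hence Q(J) = ∏_i [p_i(1|_J) = p_i(1)] is a
-- linear combination of functions [T ⊆ J] with |T| ≤ D = k m (q - 1).  The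
-- alternating sum Σ_{S ⊆ J} (-1)^{|J ∖ S|} f(S) annihilates [T ⊆ ·] unless
-- T = J, so it vanishes on Q whenever |J| > D.  If moreover Q(J) = 1, the
-- sum has a further nonzero term Q(S) with S ⊊ J; descending from J = {1..n}
-- reaches a set of size at most D on which Q does not vanish.
module Submission where

open import Defs
open import Level using (_⊔_)
import Data.Nat as Nat
open Nat using (ℕ; zero; suc; _≤_; _<_; z≤n; s≤s; _≤?_)
open import Data.Nat.Properties
  using (≤-trans; ≤-reflexive; +-mono-≤; +-monoʳ-≤; +-suc; m≤n⇒m≤1+n; <-irrefl; ≤-<-trans; ≰⇒>)
import Data.Nat.Properties as ℕₚ
open import Data.Nat.Induction using (<-wellFounded)
open import Induction.WellFounded using (Acc; acc)
import Data.Fin as Fin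
open Fin using (Fin; zero; suc; punchIn; punchOut)
open import Data.Fin.Properties using (¬Fin0; punchInᵢ≢i; punchIn-punchOut)
open import Data.Fin.Subset using (Subset; ∣_∣; ⊥; ⊤; _∪_)
open import Data.Fin.Subset.Properties using (∣⊥∣≡0; ∣p∣≤∣x∷p∣)
open import Data.Vec using ([]; _∷_; lookup)
open import Data.Bool using (true; false)
open import Data.Product using (∃; _×_; _,_; proj₁; proj₂)
open import Data.List using ([]; _∷_)
open import Data.List.Relation.Unary.All using (All; []; _∷_)
open import Function using (_∘_)
open import Relation.Nullary using (¬_; yes; no; contradiction)
open import Relation.Nullary.Decidable using (map′)
open import Relation.Binary.Definitions using (Decidable)
import Relation.Binary.PropositionalEquality as ≡
open ≡ using (_≡_; _≢_)
open import Algebra.Bundles using (CommutativeRing)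

∣p∪q∣≤∣p∣+∣q∣ : ∀ {n} (p q : Subset n) → ∣ p ∪ q ∣ ≤ ∣ p ∣ Nat.+ ∣ q ∣
∣p∪q∣≤∣p∣+∣q∣ []          []          = z≤n
∣p∪q∣≤∣p∣+∣q∣ (true ∷ p)  (x ∷ q)     =
  s≤s (≤-trans (∣p∪q∣≤∣p∣+∣q∣ p q) (+-monoʳ-≤ ∣ p ∣ (∣p∣≤∣x∷p∣ x q)))
∣p∪q∣≤∣p∣+∣q∣ (false ∷ p) (true ∷ q)  =
  ≤-trans (s≤s (∣p∪q∣≤∣p∣+∣q∣ p q)) (≤-reflexive (≡.sym (+-suc ∣ p ∣ ∣ q ∣)))
∣p∪q∣≤∣p∣+∣q∣ (false ∷ p) (false ∷ q) = ∣p∪q∣≤∣p∣+∣q∣ p q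

module BooleanCube {c ℓ} (R : CommutativeRing c ℓ) where
  open CommutativeRing R hiding (zero)
  open import Algebra.Properties.Ring ring
    using (-0#≈0#; -‿+-comm; x[y-z]≈xy-xz)
  import Algebra.Properties.CommutativeSemigroup +-commutativeSemigroup as +-Props
  import Algebra.Properties.CommutativeSemigroup *-commutativeSemigroup as *-Props
  open import Algebra.Properties.Monoid.Sum *-monoid using () renaming (sum to ∏)

  x-0#≈x : ∀ x → x - 0# ≈ x
  x-0#≈x x = trans (+-congˡ -0#≈0#) (+-identityʳ x)

  +-minus-interchange : ∀ a b a′ b′ → (a + b) - (a′ + b′) ≈ (a - a′) + (b - b′)
  +-minus-interchange a b a′ b′ =
    trans (+-congˡ (sym (-‿+-comm a′ b′))) (+-Props.interchange a b (- a′) (- b′))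

  -- ⊆-indicator T is the multilinear monomial ∏_{i ∈ T} x_i on the cube.
  ⊆-indicator : ∀ {n} → Subset n → Subset n → Carrier
  ⊆-indicator []          []          = 1#
  ⊆-indicator (true ∷ T)  (true ∷ S)  = ⊆-indicator T S
  ⊆-indicator (true ∷ T)  (false ∷ S) = 0#
  ⊆-indicator (false ∷ T) (_ ∷ S)     = ⊆-indicator T S

  ⊆-indicator-⊥ : ∀ {n} (S : Subset n) → ⊆-indicator ⊥ S ≈ 1#
  ⊆-indicator-⊥ []      = refl
  ⊆-indicator-⊥ (_ ∷ S) = ⊆-indicator-⊥ S

  ⊆-indicator-∪ : ∀ {n} (T U S : Subset n) →
                  ⊆-indicator (T ∪ U) S ≈ ⊆-indicator T S * ⊆-indicator U S
  ⊆-indicator-∪ []          []          []          = sym (*-identityˡ 1#)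
  ⊆-indicator-∪ (true ∷ T)  (true ∷ U)  (true ∷ S)  = ⊆-indicator-∪ T U S
  ⊆-indicator-∪ (true ∷ T)  (false ∷ U) (true ∷ S)  = ⊆-indicator-∪ T U S
  ⊆-indicator-∪ (true ∷ T)  (_ ∷ U)     (false ∷ S) = sym (zeroˡ _)
  ⊆-indicator-∪ (false ∷ T) (true ∷ U)  (true ∷ S)  = ⊆-indicator-∪ T U S
  ⊆-indicator-∪ (false ∷ T) (true ∷ U)  (false ∷ S) = sym (zeroʳ _)
  ⊆-indicator-∪ (false ∷ T) (false ∷ U) (_ ∷ S)     = ⊆-indicator-∪ T U S

  alternatingSum : ∀ {n} → Subset n → (Subset n → Carrier) → Carrier
  alternatingSum []          f = f []
  alternatingSum (true ∷ J)  f =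
    alternatingSum J (f ∘ (true ∷_)) - alternatingSum J (f ∘ (false ∷_))
  alternatingSum (false ∷ J) f = alternatingSum J (f ∘ (false ∷_))

  alternatingSum-cong : ∀ {n} (J : Subset n) {f g} → (∀ S → f S ≈ g S) →
                        alternatingSum J f ≈ alternatingSum J g
  alternatingSum-cong []          f≈g = f≈g []
  alternatingSum-cong (true ∷ J)  f≈g =
    +-cong (alternatingSum-cong J (f≈g ∘ (true ∷_)))
           (-‿cong (alternatingSum-cong J (f≈g ∘ (false ∷_))))
  alternatingSum-cong (false ∷ J) f≈g = alternatingSum-cong J (f≈g ∘ (false ∷_))

  alternatingSum-zero : ∀ {n} (J : Subset n) {f} → (∀ S → f S ≈ 0#) →
                        alternatingSum J f ≈ 0#
  alternatingSum-zero []          f≈0 = f≈0 []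
  alternatingSum-zero (true ∷ J)  f≈0 =
    trans (+-cong (alternatingSum-zero J (f≈0 ∘ (true ∷_)))
                  (-‿cong (alternatingSum-zero J (f≈0 ∘ (false ∷_)))))
          (x-0#≈x 0#)
  alternatingSum-zero (false ∷ J) f≈0 = alternatingSum-zero J (f≈0 ∘ (false ∷_))

  alternatingSum-+ : ∀ {n} (J : Subset n) f g →
                     alternatingSum J (λ S → f S + g S) ≈ alternatingSum J f + alternatingSum J g
  alternatingSum-+ []          f g = refl
  alternatingSum-+ (true ∷ J)  f g =
    trans (+-cong (alternatingSum-+ J _ _) (-‿cong (alternatingSum-+ J _ _)))
          (+-minus-interchange _ _ _ _)
  alternatingSum-+ (false ∷ J) f g = alternatingSum-+ J _ _

  alternatingSum-*ˡ : ∀ {n} (J : Subset n) a f →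
                      alternatingSum J (λ S → a * f S) ≈ a * alternatingSum J f
  alternatingSum-*ˡ []          a f = refl
  alternatingSum-*ˡ (true ∷ J)  a f =
    trans (+-cong (alternatingSum-*ˡ J a _) (-‿cong (alternatingSum-*ˡ J a _)))
          (sym (x[y-z]≈xy-xz a _ _))
  alternatingSum-*ˡ (false ∷ J) a f = alternatingSum-*ˡ J a _

  alternatingSum-⊆-indicator : ∀ {n} (J T : Subset n) → T ≢ J →
                               alternatingSum J (⊆-indicator T) ≈ 0#
  alternatingSum-⊆-indicator []          []          T≢J = contradiction ≡.refl T≢J
  alternatingSum-⊆-indicator (true ∷ J)  (true ∷ T)  T≢J =
    trans (+-congˡ (-‿cong (alternatingSum-zero J (λ _ → refl))))
          (trans (x-0#≈x _) (alternatingSum-⊆-indicator J T (T≢J ∘ ≡.cong (true ∷_))))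
  alternatingSum-⊆-indicator (true ∷ J)  (false ∷ T) T≢J = -‿inverseʳ _
  alternatingSum-⊆-indicator (false ∷ J) (true ∷ T)  T≢J = alternatingSum-zero J (λ _ → refl)
  alternatingSum-⊆-indicator (false ∷ J) (false ∷ T) T≢J =
    alternatingSum-⊆-indicator J T (T≢J ∘ ≡.cong (false ∷_))

  data Degree≤ {n} (d : ℕ) : (Subset n → Carrier) → Set (c ⊔ ℓ) where
    monomial : ∀ a T → ∣ T ∣ ≤ d → Degree≤ d (λ S → a * ⊆-indicator T S)
    _⊕_      : ∀ {f g} → Degree≤ d f → Degree≤ d g → Degree≤ d (λ S → f S + g S)
    resp     : ∀ {f g} → (∀ S → f S ≈ g S) → Degree≤ d f → Degree≤ d g

  alternatingSum-Degree< : ∀ {n d} {f : Subset n → Carrier} (J : Subset n) →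
                           Degree≤ d f → d < ∣ J ∣ → alternatingSum J f ≈ 0#
  alternatingSum-Degree< J (monomial a T ∣T∣≤d) d<∣J∣ =
    trans (alternatingSum-*ˡ J a _)
          (trans (*-congˡ (alternatingSum-⊆-indicator J T T≢J)) (zeroʳ a))
    where
      T≢J : T ≢ J
      T≢J T≡J = <-irrefl (≡.cong ∣_∣ T≡J) (≤-<-trans ∣T∣≤d d<∣J∣)
  alternatingSum-Degree< J (df ⊕ dg) d<∣J∣ =
    trans (alternatingSum-+ J _ _)
          (trans (+-cong (alternatingSum-Degree< J df d<∣J∣) (alternatingSum-Degree< J dg d<∣J∣))
                 (+-identityʳ 0#))
  alternatingSum-Degree< J (resp f≈g df) d<∣J∣ =
    trans (sym (alternatingSum-cong J f≈g)) (alternatingSum-Degree< J df d<∣J∣)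

  Degree≤-const : ∀ {n d} a → Degree≤ {n} d (λ _ → a)
  Degree≤-const {n} a =
    resp (λ S → trans (*-congˡ (⊆-indicator-⊥ S)) (*-identityʳ a))
         (monomial a ⊥ (≤-trans (≤-reflexive (∣⊥∣≡0 n)) z≤n))

  Degree≤-*-monomial : ∀ {n d e} {g : Subset n → Carrier} a T → ∣ T ∣ ≤ d → Degree≤ e g →
                       Degree≤ (d Nat.+ e) (λ S → (a * ⊆-indicator T S) * g S)
  Degree≤-*-monomial a T ∣T∣≤d (monomial b U ∣U∣≤e) =
    resp (λ S → trans (*-congˡ (⊆-indicator-∪ T U S)) (*-Props.interchange a b _ _))
         (monomial (a * b) (T ∪ U) (≤-trans (∣p∪q∣≤∣p∣+∣q∣ T U) (+-mono-≤ ∣T∣≤d ∣U∣≤e)))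
  Degree≤-*-monomial a T ∣T∣≤d (dg ⊕ dh) =
    resp (λ S → sym (distribˡ _ _ _))
         (Degree≤-*-monomial a T ∣T∣≤d dg ⊕ Degree≤-*-monomial a T ∣T∣≤d dh)
  Degree≤-*-monomial a T ∣T∣≤d (resp g≈h dg) =
    resp (λ S → *-congˡ (g≈h S)) (Degree≤-*-monomial a T ∣T∣≤d dg)

  Degree≤-* : ∀ {n d e} {f g : Subset n → Carrier} → Degree≤ d f → Degree≤ e g →
              Degree≤ (d Nat.+ e) (λ S → f S * g S)
  Degree≤-* (monomial a T ∣T∣≤d) dg = Degree≤-*-monomial a T ∣T∣≤d dg
  Degree≤-* (df ⊕ dh)            dg =
    resp (λ S → sym (distribʳ _ _ _)) (Degree≤-* df dg ⊕ Degree≤-* dh dg)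
  Degree≤-* (resp f≈h df)        dg = resp (λ S → *-congʳ (f≈h S)) (Degree≤-* df dg)

  Degree≤-∏ : ∀ {n d} m {fs : Fin m → Subset n → Carrier} → (∀ i → Degree≤ d (fs i)) →
              Degree≤ (m Nat.* d) (λ S → ∏ (λ i → fs i S))
  Degree≤-∏ zero    dfs = Degree≤-const 1#
  Degree≤-∏ (suc m) dfs = Degree≤-* (dfs zero) (Degree≤-∏ m (dfs ∘ suc))

  ∏-zero : ∀ {m} (h : Fin m → Carrier) i → h i ≈ 0# → ∏ h ≈ 0#
  ∏-zero h zero    hi≈0 = trans (*-congʳ hi≈0) (zeroˡ _)
  ∏-zero h (suc i) hi≈0 = trans (*-congˡ (∏-zero (h ∘ suc) i hi≈0)) (zeroʳ _)

  ∏-one : ∀ {m} (h : Fin m → Carrier) → (∀ i → h i ≈ 1#) → ∏ h ≈ 1#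
  ∏-one {zero}  h h≈1 = refl
  ∏-one {suc m} h h≈1 =
    trans (*-cong (h≈1 zero) (∏-one (h ∘ suc) (h≈1 ∘ suc))) (*-identityˡ 1#)

  module _ (_≈?_ : Decidable _≈_) where

    ∃-nonzero : ∀ {n} (J : Subset n) f → ¬ alternatingSum J f ≈ 0# →
                ∃ λ S → ∣ S ∣ ≤ ∣ J ∣ × ¬ f S ≈ 0#
    ∃-nonzero []          f Σ≉0 = [] , z≤n , Σ≉0
    ∃-nonzero (true ∷ J)  f Σ≉0 with alternatingSum J (f ∘ (true ∷_)) ≈? 0#
    ... | no  A≉0 with ∃-nonzero J (f ∘ (true ∷_)) A≉0
    ...   | S , ∣S∣≤∣J∣ , fS≉0 = true ∷ S , s≤s ∣S∣≤∣J∣ , fS≉0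
    ∃-nonzero (true ∷ J)  f Σ≉0 | yes A≈0
      with ∃-nonzero J (f ∘ (false ∷_))
                     (λ B≈0 → Σ≉0 (trans (+-cong A≈0 (-‿cong B≈0)) (x-0#≈x 0#)))
    ... | S , ∣S∣≤∣J∣ , fS≉0 = false ∷ S , m≤n⇒m≤1+n ∣S∣≤∣J∣ , fS≉0
    ∃-nonzero (false ∷ J) f Σ≉0 with ∃-nonzero J (f ∘ (false ∷_)) Σ≉0
    ... | S , ∣S∣≤∣J∣ , fS≉0 = false ∷ S , ∣S∣≤∣J∣ , fS≉0

    -- The only summand with S = J is f J, so a discrepancy comes from a smaller S.
    ∃-smaller-nonzero : ∀ {n} (J : Subset n) f → ¬ alternatingSum J f ≈ f J →
                        ∃ λ S → ∣ S ∣ < ∣ J ∣ × ¬ f S ≈ 0#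
    ∃-smaller-nonzero []          f Σ≉fJ = contradiction refl Σ≉fJ
    ∃-smaller-nonzero (true ∷ J)  f Σ≉fJ with alternatingSum J (f ∘ (false ∷_)) ≈? 0#
    ... | no  B≉0 with ∃-nonzero J (f ∘ (false ∷_)) B≉0
    ...   | S , ∣S∣≤∣J∣ , fS≉0 = false ∷ S , s≤s ∣S∣≤∣J∣ , fS≉0
    ∃-smaller-nonzero (true ∷ J)  f Σ≉fJ | yes B≈0
      with ∃-smaller-nonzero J (f ∘ (true ∷_))
                             (λ A≈fJ → Σ≉fJ (trans (+-congˡ (-‿cong B≈0)) (trans (x-0#≈x _) A≈fJ)))
    ... | S , ∣S∣<∣J∣ , fS≉0 = true ∷ S , s≤s ∣S∣<∣J∣ , fS≉0
    ∃-smaller-nonzero (false ∷ J) f Σ≉fJ with ∃-smaller-nonzero J (f ∘ (false ∷_)) Σ≉fJ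
    ... | S , ∣S∣<∣J∣ , fS≉0 = false ∷ S , ∣S∣<∣J∣ , fS≉0

    Degree≤⇒∃-small-nonzero : ∀ {n d} {f : Subset n → Carrier} → Degree≤ d f →
                              ∀ J → ¬ f J ≈ 0# → ∃ λ S → ∣ S ∣ ≤ d × ¬ f S ≈ 0#
    Degree≤⇒∃-small-nonzero {d = d} {f} df J fJ≉0 = descend J (<-wellFounded ∣ J ∣) fJ≉0
      where
        descend : ∀ J → Acc _<_ ∣ J ∣ → ¬ f J ≈ 0# → ∃ λ S → ∣ S ∣ ≤ d × ¬ f S ≈ 0#
        descend J (acc smaller) fJ≉0 with ∣ J ∣ ≤? d
        ... | yes ∣J∣≤d = J , ∣J∣≤d , fJ≉0
        ... | no  ∣J∣≰d with ∃-smaller-nonzero J f Σ≉fJ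
          where
            Σ≉fJ : ¬ alternatingSum J f ≈ f J
            Σ≉fJ Σ≈fJ = fJ≉0 (trans (sym Σ≈fJ) (alternatingSum-Degree< J df (≰⇒> ∣J∣≰d)))
        ... | S , ∣S∣<∣J∣ , fS≉0 = descend S (smaller ∣S∣<∣J∣) fS≉0

module Polynomial {c ℓ} (F : Field c ℓ) where
  open Field F hiding (zero)
  open BooleanCube commutativeRing

  support : ∀ {n} → Monomial F n → Subset n
  support {zero}  e = []
  support {suc n} e with e zero
  ... | zero  = false ∷ support (e ∘ suc)
  ... | suc _ = true  ∷ support (e ∘ suc)

  ∣support∣≡numVars : ∀ {n} (e : Monomial F n) → ∣ support e ∣ ≡ numVars e
  ∣support∣≡numVars {zero}  e = ≡.refl
  ∣support∣≡numVars {suc n} e with e zero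
  ... | zero  = ∣support∣≡numVars (e ∘ suc)
  ... | suc _ = ≡.cong suc (∣support∣≡numVars (e ∘ suc))

  pow-1# : ∀ e → pow F 1# e ≈ 1#
  pow-1# zero    = refl
  pow-1# (suc e) = trans (*-identityˡ _) (pow-1# e)

  evalMono-indicator : ∀ {n} (e : Monomial F n) (S : Subset n) →
                       evalMono F e (indicator F (lookup S)) ≈ ⊆-indicator (support e) S
  evalMono-indicator {zero}  e []      = refl
  evalMono-indicator {suc n} e (s ∷ S) with e zero
  ... | zero  = trans (*-identityˡ _) (evalMono-indicator (e ∘ suc) S)
  ... | suc k with s
  ...   | true  =
    trans (*-congʳ (pow-1# (suc k))) (trans (*-identityˡ _) (evalMono-indicator (e ∘ suc) S))
  ...   | false = trans (*-congʳ (zeroˡ _)) (zeroˡ _)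

  Degree≤-eval-indicator : ∀ {n k} (p : Poly F n) → All (λ t → numVars (proj₂ t) ≤ k) p →
                           Degree≤ k (λ S → eval F p (indicator F (lookup S)))
  Degree≤-eval-indicator []            []               = Degree≤-const 0#
  Degree≤-eval-indicator {k = k} ((a , e) ∷ p) (numVars≤k ∷ p≤k) =
    resp (λ S → +-congʳ (*-congˡ (sym (evalMono-indicator e S))))
         (monomial a (support e) ∣support∣≤k ⊕ Degree≤-eval-indicator p p≤k)
    where
      ∣support∣≤k : ∣ support e ∣ ≤ k
      ∣support∣≤k = ≤-trans (≤-reflexive (∣support∣≡numVars e)) numVars≤k

  evalMono-indicator-⊤ : ∀ {n} (e : Monomial F n) →
                         evalMono F e (indicator F (lookup ⊤)) ≡ evalMono F e (ones F)
  evalMono-indicator-⊤ {zero}  e = ≡.refl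
  evalMono-indicator-⊤ {suc n} e = ≡.cong (pow F 1# (e zero) *_) (evalMono-indicator-⊤ (e ∘ suc))

  eval-indicator-⊤ : ∀ {n} (p : Poly F n) → eval F p (indicator F (lookup ⊤)) ≡ eval F p (ones F)
  eval-indicator-⊤ []            = ≡.refl
  eval-indicator-⊤ ((a , e) ∷ p) =
    ≡.cong₂ (λ x y → a * x + y) (evalMono-indicator-⊤ e) (eval-indicator-⊤ p)

module FiniteField {c ℓ} (F : Field c ℓ) {q : ℕ} (F-card : HasCardinality F (suc q)) where
  open Field F hiding (zero)
  open HasCardinality F-card
  open BooleanCube commutativeRing
  open import Algebra.Properties.Ring ring using (-‿distribˡ-*; x≈y⇒x∙y⁻¹≈ε; x∙y⁻¹≈ε⇒x≈y)
  open import Algebra.Properties.Monoid.Sum *-monoid using () renaming (sum to ∏)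

  index : Carrier → Fin (suc q)
  index x = proj₁ (enum-surj x)

  enum-index : ∀ x → enum (index x) ≈ x
  enum-index x = proj₂ (enum-surj x) ≡.refl

  index-injective : ∀ {x y} → index x ≡ index y → x ≈ y
  index-injective {x} {y} ix≡iy =
    trans (sym (enum-index x)) (trans (reflexive (≡.cong enum ix≡iy)) (enum-index y))

  index-cong : ∀ {x y} → x ≈ y → index x ≡ index y
  index-cong {x} {y} x≈y = enum-inj (trans (enum-index x) (trans x≈y (sym (enum-index y))))

  _≈?_ : Decidable _≈_
  x ≈? y = map′ index-injective index-cong (index x Fin.≟ index y)

  nonzero : Fin q → Carrier
  nonzero j = enum (punchIn (index 0#) j)

  nonzero≉0# : ∀ j → ¬ nonzero j ≈ 0#
  nonzero≉0# j nonzero≈0 =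
    punchInᵢ≢i (index 0#) j (enum-inj (trans nonzero≈0 (sym (enum-index 0#))))

  nonzero⁻¹ : Fin q → Carrier
  nonzero⁻¹ j = proj₁ (inverse (nonzero j) (nonzero≉0# j))

  isZero : Carrier → Carrier
  isZero z = ∏ (λ j → 1# - z * nonzero⁻¹ j)

  isZero-0# : ∀ {z} → z ≈ 0# → isZero z ≈ 1#
  isZero-0# {z} z≈0 = ∏-one (λ j → 1# - z * nonzero⁻¹ j) λ j →
    trans (+-congˡ (-‿cong (trans (*-congʳ z≈0) (zeroˡ _)))) (x-0#≈x 1#)

  isZero≉0#⇒≈0# : ∀ {z} → ¬ isZero z ≈ 0# → z ≈ 0#
  isZero≉0#⇒≈0# {z} isZero≉0 with z ≈? 0#
  ... | yes z≈0 = z≈0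
  ... | no  z≉0 = contradiction (∏-zero _ j factor≈0) isZero≉0
    where
      0≢z : index 0# ≢ index z
      0≢z 0≡z = z≉0 (sym (index-injective 0≡z))
      j : Fin q
      j = punchOut 0≢z
      nonzero≈z : nonzero j ≈ z
      nonzero≈z = trans (reflexive (≡.cong enum (punchIn-punchOut 0≢z))) (enum-index z)
      factor≈0 : 1# - z * nonzero⁻¹ j ≈ 0#
      factor≈0 = trans (+-congˡ (-‿cong (trans (*-congʳ (sym nonzero≈z)) (proj₂ (inverse _ _)))))
                       (-‿inverseʳ 1#)

  Degree≤-isZero : ∀ {n k} {G : Subset n → Carrier} → Degree≤ k G → Degree≤ (q Nat.* k) (isZero ∘ G)
  Degree≤-isZero dG = Degree≤-∏ q λ j →
    resp (λ S → +-congˡ (trans (sym (-‿distribˡ-* _ _)) (-‿cong (*-comm _ _))))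
         (Degree≤-const 1# ⊕ Degree≤-* (Degree≤-const (- nonzero⁻¹ j)) dG)

  -- Q is nonzero exactly at the common solutions of P i S ≈ v i.
  ∃-small-common-solution : ∀ {n m k} (P : Fin m → Subset n → Carrier) (v : Fin m → Carrier) →
                            (∀ i → Degree≤ k (P i)) → ∀ J → (∀ i → P i J ≈ v i) →
                            ∃ λ S → ∣ S ∣ ≤ m Nat.* (q Nat.* k) × ∀ i → P i S ≈ v i
  ∃-small-common-solution {n} {m} {k} P v dP J PJ≈v
    with Degree≤⇒∃-small-nonzero _≈?_ degQ J QJ≉0
    where
      Q : Subset n → Carrier
      Q S = ∏ (λ i → isZero (P i S - v i))
      degQ : Degree≤ (m Nat.* (q Nat.* k)) Q
      degQ = Degree≤-∏ m λ i → Degree≤-isZero (dP i ⊕ Degree≤-const (- v i))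
      QJ≉0 : ¬ Q J ≈ 0#
      QJ≉0 QJ≈0 = 0≉1 (trans (sym QJ≈0) (∏-one _ λ i → isZero-0# (x≈y⇒x∙y⁻¹≈ε (PJ≈v i))))
  ... | S , ∣S∣≤ , QS≉0 =
    S , ∣S∣≤ , λ i → x∙y⁻¹≈ε⇒x≈y _ _ (isZero≉0#⇒≈0# (QS≉0 ∘ ∏-zero _ i))

open Nat using (_*_; _∸_)

lemma2p1 : ∀ {c ℓ} (F : Field c ℓ) (q : ℕ) → HasCardinality F q →
    (k m n : ℕ) → 1 ≤ k → 1 ≤ m → 1 ≤ n →
    (p : Fin m → Poly F n) →
    (∀ i → All (λ t → numVars (proj₂ t) ≤ k) (p i)) →
    ∃ λ (J : Subset n) → ∣ J ∣ ≤ k * m * (q ∸ 1) ×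
    (∀ i → Field._≈_ F (eval F (p i) (indicator F (lookup J))) (eval F (p i) (ones F)))
lemma2p1 F zero F-card k m n _ _ _ p p≤k =
  contradiction (proj₁ (HasCardinality.enum-surj F-card (Field.0# F))) ¬Fin0
lemma2p1 F (suc q) F-card k m n _ _ _ p p≤k
  with ∃-small-common-solution P v (λ i → Degree≤-eval-indicator (p i) (p≤k i))
                               ⊤ (λ i → Field.reflexive F (eval-indicator-⊤ (p i)))
  where
    open Polynomial F
    open FiniteField F F-card
    P : Fin m → Subset n → Field.Carrier F
    P i S = eval F (p i) (indicator F (lookup S))
    v : Fin m → Field.Carrier F
    v i = eval F (p i) (ones F)
... | J , ∣J∣≤ , PJ≈v = J , ≤-trans ∣J∣≤ (≤-reflexive m*[q*k]≡k*m*q) , PJ≈v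
  where
    open ≡.≡-Reasoning
    m*[q*k]≡k*m*q : m * (q * k) ≡ k * m * q
    m*[q*k]≡k*m*q = begin
      m * (q * k) ≡⟨ ≡.cong (m *_) (ℕₚ.*-comm q k) ⟩
      m * (k * q) ≡⟨ ℕₚ.*-assoc m k q ⟨
      m * k * q   ≡⟨ ≡.cong (_* q) (ℕₚ.*-comm m k) ⟩
      k * m * q   ∎
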